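{- Let $\mathcal{F}$ be a finite family of graphs, let $\mathcal{C}=\{C(F):F\in\mathcal{F}\}$ be the set of cores of its members, and let $K(\mathcal{F})\in\mathcal{C}$ be a maximal element with respect to $\preceq$, i.e. for every $C\in\mathcal{C}$ with a homomorphism from $C$ to $K(\mathcal{F})$ we have $C\cong K(\mathcal{F})$. Then for every $F\in\mathcal{F}$ and every homomorphism $f:F\to K(\mathcal{F})$ there is a set $X\subseteq V(F)$ such that $f|_X$ is an isomorphism from $F[X]$ onto $K(\mathcal{F})$.
   Context: A homomorphism from $G_1$ to $G_2$ is a map $f:V(G_1)\to V(G_2)$ with $(f(u),f(v))\in E(G_2)$ whenever $(u,v)\in E(G_1)$. The core $C(G)$ of a graph $G$ is a smallest (in number of vertices) induced subgraph of $G$ to which $G$ has a homomorphism. For graphs $G_1,G_2$, write $G_1\preceq G_2$ if there is a homomorphism from $G_2$ to $G_1$; on $\mathcal{C}$ this is a partial order up to isomorphism. -}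

module Defs where

open import Data.Nat using (ℕ; _≤_)
open import Data.Fin using (Fin)
open import Data.Fin.Subset using (Subset; _∈_)
open import Data.Bool using (Bool; true; false)
open import Data.Product using (Σ; _×_; _,_; ∃; ∃-syntax; proj₁)
open import Relation.Binary.PropositionalEquality using (_≡_)
open import Function.Bundles using (_⇔_)

record Graph : Set where
  field
    n     : ℕ
    adj   : Fin n → Fin n → Bool
    sym   : ∀ u v → adj u v ≡ adj v u
    irrefl : ∀ u → adj u u ≡ false

open Graph public

V : Graph → Set
V G = Fin (n G)

E : (G : Graph) → V G → V G → Set
E G u v = adj G u v ≡ true

Hom : Graph → Graph → Set
Hom G₁ G₂ = Σ (V G₁ → V G₂) λ f → ∀ u v → E G₁ u v → E G₂ (f u) (f v)

_≅_ : Graph → Graph → Set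
G₁ ≅ G₂ = Σ (V G₁ → V G₂) λ f → Σ (V G₂ → V G₁) λ g →
  (∀ u → g (f u) ≡ u) × (∀ w → f (g w) ≡ w) ×
  (∀ u v → E G₁ u v ⇔ E G₂ (f u) (f v))

InducedSub : Graph → Graph → Set
InducedSub D G = Σ (V D → V G) λ ι →
  (∀ i j → ι i ≡ ι j → i ≡ j) × (∀ i j → E D i j ⇔ E G (ι i) (ι j))

IsCoreOf : Graph → Graph → Set
IsCoreOf C G = InducedSub C G × Hom G C ×
  (∀ D → InducedSub D G → Hom G D → n C ≤ n D)

RestrictionIsIso : (F K : Graph) → (V F → V K) → Subset (n F) → Set
RestrictionIsIso F K f X =
  (∀ u v → u ∈ X → v ∈ X → f u ≡ f v → u ≡ v) ×
  (∀ w → ∃[ u ] (u ∈ X × f u ≡ w)) ×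
  (∀ u v → u ∈ X → v ∈ X → (E F u v ⇔ E K (f u) (f v)))

-- Take a core C of F, embedded in F by ι. Composing with f gives a homomorphism C → K,
-- so maximality of K makes C ≅ K. Every endomorphism of the core K is surjective (otherwise
-- a smaller retract exists), hence a bijection of a finite set, hence it also reflects edges
-- (some power of it is the identity on pairs of vertices). Therefore f ∘ ι is an isomorphism
-- C → K, and X = ι(V(C)) is the required set.
module Submission where

open import Defs
open import Data.Nat using (ℕ; zero; suc; _<_; _≤_; s≤s)
open import Data.Nat.Induction using (<-rec)
open import Data.Nat.Properties using (anyUpTo?; ≮⇒≥; n<1+n; <⇒≱)
open import Data.Fin using (Fin; toℕ; punchIn; punchOut; combine; _≟_)
open import Data.Fin.Properties using (any?; all?; pigeonhole; injective⇒≤; combine-injective;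
  punchIn-injective; punchIn-punchOut; punchOut-injective)
open import Data.Fin.Subset using (Subset; _∈_)
open import Data.Bool using (true)
import Data.Bool.Properties as Bool
open import Data.Vec using (Vec; []; _∷_; lookup; tabulate)
open import Data.Vec.Properties using (lookup∘tabulate; []=⇒lookup; lookup⇒[]=)
open import Data.Product using (Σ; _×_; ∃; ∃₂; ∃-syntax; _,_; proj₁; proj₂; map; uncurry)
open import Function using (_∘_; id)
open import Function.Bundles using (_⇔_; mk⇔; Equivalence)
open import Function.Definitions using (Injective; StrictlySurjective)
import Function.Properties.Equivalence as ⇔
open import Relation.Binary.PropositionalEquality
  using (_≡_; _≢_; refl; cong; cong₂; subst; subst₂; module ≡-Reasoning)
  renaming (sym to ≡-sym; trans to ≡-trans)
open import Relation.Nullary using (Dec; yes; no; does; contradiction)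
open import Relation.Nullary.Decidable
  using (map′; _×-dec_; _→-dec_; isYes; isYes≗does; dec-true; toWitness)
open import Relation.Unary using (Decidable)

any-Vec? : ∀ a {b} {P : Vec (Fin b) a → Set} → Decidable P → Dec (∃ P)
any-Vec? zero    P? = map′ ([] ,_) (λ { ([] , p) → p }) (P? [])
any-Vec? (suc a) P? =
  map′ (λ { (x , v , p) → x ∷ v , p }) (λ { (x ∷ v , p) → x , v , p })
       (any? λ x → any-Vec? a (P? ∘ (x ∷_)))

Minimal : (ℕ → Set) → Set
Minimal P = ∃ λ m → P m × (∀ j → P j → m ≤ j)

minimal : {P : ℕ → Set} → Decidable P → ∀ {k} → P k → Minimal P
minimal {P} P? {k} = <-rec (λ k → P k → Minimal P) step k
  where
  step : ∀ k → (∀ {j} → j < k → P j → Minimal P) → P k → Minimal P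
  step k rec Pk with anyUpTo? P? k
  ... | yes (j , j<k , Pj) = rec j<k Pj
  ... | no none             = k , Pk , λ j Pj → ≮⇒≥ λ j<k → none (j , j<k , Pj)

injective⇒surjective : ∀ {m} {h : Fin m → Fin m} → Injective _≡_ _≡_ h → StrictlySurjective _≡_ h
injective⇒surjective {suc m} {h} h-inj w with any? (λ x → h x ≟ w)
... | yes hit  = hit
... | no  miss = contradiction (injective⇒≤ h′-inj) (<⇒≱ (n<1+n m))
  where
  h≢w : ∀ x → w ≢ h x
  h≢w x w≡hx = miss (x , ≡-sym w≡hx)
  h′ : Fin (suc m) → Fin m
  h′ x = punchOut (h≢w x)
  h′-inj : Injective _≡_ _≡_ h′
  h′-inj {x} {y} = h-inj ∘ punchOut-injective (h≢w x) (h≢w y)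

surjective⇒injective : ∀ {m} {h : Fin m → Fin m} → StrictlySurjective _≡_ h → Injective _≡_ _≡_ h
surjective⇒injective {h = h} h-surj {x} {y} hx≡hy = begin
  x         ≡⟨ ≡-sym (s∘h x) ⟩
  s (h x)   ≡⟨ cong s hx≡hy ⟩
  s (h y)   ≡⟨ s∘h y ⟩
  y         ∎
  where
  open ≡-Reasoning
  s = proj₁ ∘ h-surj
  h∘s : ∀ y → h (s y) ≡ y
  h∘s = proj₂ ∘ h-surj
  s-surj : StrictlySurjective _≡_ s
  s-surj = injective⇒surjective λ {a} {b} sa≡sb →
    ≡-trans (≡-sym (h∘s a)) (≡-trans (cong h sa≡sb) (h∘s b))
  s∘h : ∀ x → s (h x) ≡ x
  s∘h x with s-surj x
  ... | a , refl = cong s (h∘s a)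

iterate : ∀ {A : Set} → (A → A) → ℕ → A → A
iterate h zero    x = x
iterate h (suc k) x = h (iterate h k x)

iterate-sucʳ : ∀ {A : Set} (h : A → A) k x → iterate h (suc k) x ≡ iterate h k (h x)
iterate-sucʳ h zero    x = refl
iterate-sucʳ h (suc k) x = cong h (iterate-sucʳ h k x)

iterate-preserves : ∀ {A : Set} {P : A → Set} {h : A → A} → (∀ x → P x → P (h x)) →
                    ∀ k x → P x → P (iterate h k x)
iterate-preserves h-pres zero    x Px = Px
iterate-preserves h-pres (suc k) x Px = h-pres _ (iterate-preserves h-pres k x Px)

iterate-period : ∀ {A : Set} {h : A → A} → Injective _≡_ _≡_ h → ∀ {a b x} → a < b →
                 iterate h a x ≡ iterate h b x → ∃ λ k → iterate h (suc k) x ≡ x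
iterate-period h-inj {zero}  {suc k} _         eq = k , ≡-sym eq
iterate-period h-inj {suc a} {suc b} (s≤s a<b) eq = iterate-period h-inj a<b (h-inj eq)

injective⇒periodic : ∀ {A : Set} {m} {h : A → A} (enc : A → Fin m) → Injective _≡_ _≡_ enc →
                     Injective _≡_ _≡_ h → ∀ x → ∃ λ k → iterate h (suc k) x ≡ x
injective⇒periodic {m = m} {h} enc enc-inj h-inj x
  with pigeonhole (n<1+n m) (λ (i : Fin (suc m)) → enc (iterate h (toℕ i) x))
... | i , j , i<j , same = iterate-period h-inj i<j (enc-inj same)

injective-preserving⇒reflecting :
  ∀ {A : Set} {m} {P : A → Set} {h : A → A} (enc : A → Fin m) → Injective _≡_ _≡_ enc →
  Injective _≡_ _≡_ h → (∀ x → P x → P (h x)) → ∀ x → P (h x) → P x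
injective-preserving⇒reflecting {P = P} {h} enc enc-inj h-inj h-pres x Phx
  with injective⇒periodic enc enc-inj h-inj x
... | k , period = subst P period
  (subst P (≡-sym (iterate-sucʳ h k x)) (iterate-preserves h-pres k (h x) Phx))

IsIsomorphism : (G H : Graph) → (V G → V H) → Set
IsIsomorphism G H f =
  Injective _≡_ _≡_ f × StrictlySurjective _≡_ f × (∀ u v → E G u v ⇔ E H (f u) (f v))

IsIsomorphism-∘ : ∀ {G H K} {g : V H → V K} {f : V G → V H} →
                  IsIsomorphism H K g → IsIsomorphism G H f → IsIsomorphism G K (g ∘ f)
IsIsomorphism-∘ {g = g} {f} (g-inj , g-surj , g-edges) (f-inj , f-surj , f-edges) =
  f-inj ∘ g-inj ,
  (λ w → let v , gv≡w = g-surj w ; u , fu≡v = f-surj v in u , ≡-trans (cong g fu≡v) gv≡w) ,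
  λ u v → ⇔.trans (f-edges u v) (g-edges (f u) (f v))

IsIsomorphism-resp : ∀ {G H} {f f′ : V G → V H} → (∀ x → f x ≡ f′ x) →
                     IsIsomorphism G H f → IsIsomorphism G H f′
IsIsomorphism-resp {G} {H} f≗f′ (f-inj , f-surj , f-edges) =
  (λ {x} {y} eq → f-inj (≡-trans (f≗f′ x) (≡-trans eq (≡-sym (f≗f′ y))))) ,
  (λ w → let u , fu≡w = f-surj w in u , ≡-trans (≡-sym (f≗f′ u)) fu≡w) ,
  λ u v → subst₂ (λ a b → E G u v ⇔ E H a b) (f≗f′ u) (f≗f′ v) (f-edges u v)

≅⇒IsIsomorphism : ∀ {G H} → (iso : G ≅ H) → IsIsomorphism G H (proj₁ iso)
≅⇒IsIsomorphism (f , g , g∘f , f∘g , edges) =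
  (λ {x} {y} fx≡fy → ≡-trans (≡-sym (g∘f x)) (≡-trans (cong g fx≡fy) (g∘f y))) ,
  (λ w → g w , f∘g w) ,
  edges

≅-sym : ∀ {G H} → G ≅ H → H ≅ G
≅-sym {G} {H} (f , g , g∘f , f∘g , edges) = g , f , f∘g , g∘f , λ a b →
  subst₂ (λ x y → E H x y ⇔ E G (g a) (g b)) (f∘g a) (f∘g b) (⇔.sym (edges (g a) (g b)))

≅⇒Hom : ∀ {G H} → G ≅ H → Hom G H
≅⇒Hom (f , _ , _ , _ , edges) = f , λ u v → Equivalence.to (edges u v)

InducedSub⇒Hom : ∀ {D G} → InducedSub D G → Hom D G
InducedSub⇒Hom (ι , _ , edges) = ι , λ i j → Equivalence.to (edges i j)

_∘ʰ_ : ∀ {G H K} → Hom H K → Hom G H → Hom G K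
(g , g-hom) ∘ʰ (f , f-hom) = g ∘ f , λ u v → g-hom (f u) (f v) ∘ f-hom u v

induced : (G : Graph) {k : ℕ} → (Fin k → V G) → Graph
induced G {k} ι = record
  { n = k
  ; adj = λ i j → adj G (ι i) (ι j)
  ; sym = λ i j → sym G (ι i) (ι j)
  ; irrefl = λ i → irrefl G (ι i)
  }

-- ι and r are stored as vectors so that the existence of a retract of size k is decidable.
IsRetraction : (G : Graph) {k : ℕ} → (Fin k → V G) → (V G → Fin k) → Set
IsRetraction G ι r = (∀ i j → ι i ≡ ι j → i ≡ j) × (∀ u v → E G u v → E G (ι (r u)) (ι (r v)))

Retract : Graph → ℕ → Set
Retract G k = ∃₂ λ (ι : Vec (V G) k) (r : Vec (Fin k) (n G)) → IsRetraction G (lookup ι) (lookup r)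

isRetraction? : ∀ G {k} (ι : Fin k → V G) r → Dec (IsRetraction G ι r)
isRetraction? G ι r =
  (all? λ i → all? λ j → (ι i ≟ ι j) →-dec (i ≟ j)) ×-dec
  (all? λ u → all? λ v → (adj G u v Bool.≟ true) →-dec (adj G (ι (r u)) (ι (r v)) Bool.≟ true))

retract? : ∀ G k → Dec (Retract G k)
retract? G k = any-Vec? k λ ι → any-Vec? (n G) λ r → isRetraction? G (lookup ι) (lookup r)

retract-of : ∀ {G D} → InducedSub D G → Hom G D → Retract G (n D)
retract-of {G} (ι , ι-inj , ι-edges) (h , h-hom) = tabulate ι , tabulate h , inj , hom
  where
  inj : ∀ i j → lookup (tabulate ι) i ≡ lookup (tabulate ι) j → i ≡ j
  inj i j rewrite lookup∘tabulate ι i | lookup∘tabulate ι j = ι-inj i j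
  hom : ∀ u v → E G u v → E G (lookup (tabulate ι) (lookup (tabulate h) u))
                               (lookup (tabulate ι) (lookup (tabulate h) v))
  hom u v uv rewrite lookup∘tabulate h u | lookup∘tabulate h v
                   | lookup∘tabulate ι (h u) | lookup∘tabulate ι (h v) =
    Equivalence.to (ι-edges (h u) (h v)) (h-hom u v uv)

trivial-retract : ∀ G → Retract G (n G)
trivial-retract G = retract-of {G} {G} (id , (λ _ _ → id) , λ _ _ → ⇔.refl) (id , λ _ _ → id)

core-exists : ∀ G → ∃ λ C → IsCoreOf C G
core-exists G with minimal (retract? G) (trivial-retract G)
... | k , (ι , r , ι-inj , r-hom) , least =
  induced G (lookup ι) ,
  (lookup ι , ι-inj , λ _ _ → ⇔.refl) ,
  (lookup r , r-hom) ,
  λ D sub h → least (n D) (retract-of {G} {D} sub h)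

complement-of-point : ∀ {m} (w : Fin m) → ∃ λ k → k < m × Σ (Fin k → Fin m) λ δ →
                      Injective _≡_ _≡_ δ × (∀ x → x ≢ w → ∃ λ y → δ y ≡ x)
complement-of-point {suc m} w =
  m , n<1+n m , punchIn w , punchIn-injective w _ _ ,
  λ x x≢w → punchOut (x≢w ∘ ≡-sym) , punchIn-punchOut _

core-image-bound : ∀ {G K k} → IsCoreOf K G → (δ : Fin k → V K) → Injective _≡_ _≡_ δ →
                   (h : Hom G K) → (∀ u → ∃ λ y → δ y ≡ proj₁ h u) → n K ≤ k
core-image-bound {G} {K} ((ι , ι-inj , ι-edges) , _ , least) δ δ-inj (h , h-hom) covered =
  least (induced K δ) sub (y , y-hom)
  where
  sub : InducedSub (induced K δ) G
  sub = ι ∘ δ , (λ i j → δ-inj ∘ ι-inj (δ i) (δ j)) , λ i j → ι-edges (δ i) (δ j)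
  y : V G → Fin _
  y = proj₁ ∘ covered
  y-hom : ∀ u v → E G u v → E K (δ (y u)) (δ (y v))
  y-hom u v uv = subst₂ (E K) (≡-sym (proj₂ (covered u))) (≡-sym (proj₂ (covered v))) (h-hom u v uv)

core-hom-surjective : ∀ {G K} → IsCoreOf K G → (h : Hom G K) → StrictlySurjective _≡_ (proj₁ h)
core-hom-surjective {G} {K} K-core (h , h-hom) w with any? (λ u → h u ≟ w)
... | yes hit  = hit
... | no  miss with complement-of-point w
...   | k , k<nK , δ , δ-inj , covers =
  contradiction (core-image-bound {G} {K} K-core δ δ-inj (h , h-hom) h-avoids-w) (<⇒≱ k<nK)
  where
  h-avoids-w : ∀ u → ∃ λ y → δ y ≡ h u
  h-avoids-w u = covers (h u) λ hu≡w → miss (u , hu≡w)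

core-endomorphism-isIsomorphism : ∀ {G K} → IsCoreOf K G → (g : Hom K K) →
                                  IsIsomorphism K K (proj₁ g)
core-endomorphism-isIsomorphism {G} {K} K-core@(_ , r , _) (g , g-hom) = g-inj , g-surj , g-edges
  where
  g-surj : StrictlySurjective _≡_ g
  g-surj w = let u , gru≡w = core-hom-surjective {G} {K} K-core g∘r w in proj₁ r u , gru≡w
    where
    g∘r : Hom G K
    g∘r = _∘ʰ_ {G} {K} {K} (g , g-hom) r
  g-inj : Injective _≡_ _≡_ g
  g-inj = surjective⇒injective g-surj
  -- g × g is an injective self-map of V(K) × V(K) preserving the edge relation.
  g-reflects : ∀ u v → E K (g u) (g v) → E K u v
  g-reflects u v = injective-preserving⇒reflecting {P = uncurry (E K)} {h = map g g}
    (uncurry combine)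
    (λ {(a , b)} {(c , d)} eq → let a≡c , b≡d = combine-injective a b c d eq in cong₂ _,_ a≡c b≡d)
    (λ eq → cong₂ _,_ (g-inj (cong proj₁ eq)) (g-inj (cong proj₂ eq)))
    (λ (a , b) → g-hom a b)
    (u , v)
  g-edges : ∀ u v → E K u v ⇔ E K (g u) (g v)
  g-edges u v = mk⇔ (g-hom u v) (g-reflects u v)

hom-to-isomorphic-core-isIsomorphism : ∀ {G C K} → IsCoreOf K G → C ≅ K → (h : Hom C K) →
                                       IsIsomorphism C K (proj₁ h)
hom-to-isomorphic-core-isIsomorphism {G} {C} {K} K-core C≅K@(_ , _ , s⁻∘s , _) h =
  IsIsomorphism-resp {C} {K} (cong (proj₁ h) ∘ s⁻∘s)
    (IsIsomorphism-∘ {C} {K} {K} (core-endomorphism-isIsomorphism {G} {K} K-core g)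
                     (≅⇒IsIsomorphism {C} {K} C≅K))
  where
  g : Hom K K
  g = _∘ʰ_ {K} {C} {K} h (≅⇒Hom {K} {C} (≅-sym {C} {K} C≅K))

image : ∀ {k m} → (Fin k → Fin m) → Subset m
image ι = tabulate λ u → does (any? λ c → ι c ≟ u)

∈-image⁻ : ∀ {k m} (ι : Fin k → Fin m) u → u ∈ image ι → ∃ λ c → ι c ≡ u
∈-image⁻ ι u u∈ = toWitness {a? = ι⁻¹u?} (Equivalence.from Bool.T-≡ (begin
  isYes ι⁻¹u?            ≡⟨ isYes≗does ι⁻¹u? ⟩
  does ι⁻¹u?             ≡⟨ lookup∘tabulate _ u ⟨
  lookup (image ι) u     ≡⟨ []=⇒lookup u∈ ⟩
  true                   ∎))
  where
  open ≡-Reasoning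
  ι⁻¹u? = any? λ c → ι c ≟ u

∈-image : ∀ {k m} (ι : Fin k → Fin m) c → ι c ∈ image ι
∈-image ι c = lookup⇒[]= (ι c) (image ι)
  (≡-trans (lookup∘tabulate _ (ι c)) (dec-true (any? λ c′ → ι c′ ≟ ι c) (c , refl)))

restriction-to-image-isIso : ∀ {C F K} → (ι : V C → V F) → (∀ i j → E C i j ⇔ E F (ι i) (ι j)) →
                             (f : V F → V K) → IsIsomorphism C K (f ∘ ι) →
                             RestrictionIsIso F K f (image ι)
restriction-to-image-isIso {F = F} {K} ι ι-edges f (fι-inj , fι-surj , fι-edges) =
  injective , onto , edges
  where
  injective : ∀ u v → u ∈ image ι → v ∈ image ι → f u ≡ f v → u ≡ v
  injective u v u∈ v∈ with ∈-image⁻ ι u u∈ | ∈-image⁻ ι v v∈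
  ... | c , refl | d , refl = cong ι ∘ fι-inj
  onto : ∀ w → ∃ λ u → u ∈ image ι × f u ≡ w
  onto w = let c , fιc≡w = fι-surj w in ι c , ∈-image ι c , fιc≡w
  edges : ∀ u v → u ∈ image ι → v ∈ image ι → E F u v ⇔ E K (f u) (f v)
  edges u v u∈ v∈ with ∈-image⁻ ι u u∈ | ∈-image⁻ ι v v∈
  ... | c , refl | d , refl = ⇔.trans (⇔.sym (ι-edges c d)) (fι-edges c d)

proposition3p5 : (N : ℕ) (ℱ : Fin N → Graph) (K : Graph)
    → (∃[ i₀ ] IsCoreOf K (ℱ i₀))
    → (∀ i C → IsCoreOf C (ℱ i) → Hom C K → C ≅ K)
    → ∀ i (f : Hom (ℱ i) K) → ∃[ X ] RestrictionIsIso (ℱ i) K (proj₁ f) X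
proposition3p5 N ℱ K (i₀ , K-core) K-maximal i f with core-exists (ℱ i)
... | C , C-core@(C↪F@(ι , _ , ι-edges) , _) =
  image ι , restriction-to-image-isIso {C} {ℱ i} {K} ι ι-edges (proj₁ f)
    (hom-to-isomorphic-core-isIsomorphism {ℱ i₀} {C} {K} K-core (K-maximal i C C-core f∘ι) f∘ι)
  where
  f∘ι : Hom C K
  f∘ι = _∘ʰ_ {C} {ℱ i} {K} f (InducedSub⇒Hom {C} {ℱ i} C↪F)
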